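{- Let $\pi=\pi_1\cdots\pi_n$ be a colored permutation in $C_r\wr S_n$ with $\pi_n\ne 1^{r-1}$. Then $\mathrm{maj}(c.\pi)=\mathrm{maj}(\pi)+1$.
   Context: $\mathcal{A}_{n,r}=\{i^j:1\le i\le n,0\le j\le r-1\}$ ($i^j$ is letter $i$ with color $j$), totally ordered by $1^{r-1}\prec\cdots\prec n^{r-1}\prec1^{r-2}\prec\cdots\prec n^{r-2}\prec\cdots\prec1^0\prec\cdots\prec n^0$. $C_r\wr S_n$ is the set of words $\pi_1\cdots\pi_n$ in $\mathcal{A}_{n,r}$ containing exactly one copy (of some color) of each $i\in[n]$; with color sequence $(\epsilon_1,\dots,\epsilon_n)$, $\mathrm{maj}(\pi)=r\sum_{p:\pi_{p+1}\prec\pi_p}p+\sum_p\epsilon_p$. The map $c$ on $\mathcal{A}_{n,r}$ is the cycle $n^0\to(n-1)^0\to\cdots\to1^0\to n^1\to(n-1)^1\to\cdots\to1^1\to\cdots\to n^{r-1}\to\cdots\to1^{r-1}\to n^0$, i.e. $c(i^j)=(i-1)^j$ for $i>1$, $c(1^j)=n^{j+1}$ for $j<r-1$, and $c(1^{r-1})=n^0$; and $c.\pi=c(\pi_1)\cdots c(\pi_n)$. -}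

module Defs where

open import Data.Nat using (ℕ; zero; suc; _+_; _*_; _∸_; _<_; _<ᵇ_; _≡ᵇ_)
open import Data.Bool using (Bool; true; false; if_then_else_; _∧_; _∨_)
open import Data.Product using (_×_; _,_; proj₁; proj₂)
open import Data.List using (List; []; _∷_; map; applyUpTo)
open import Data.Nat.ListAction using (sum)
open import Data.List.Relation.Unary.All using (All)
open import Data.List.Relation.Binary.Permutation.Propositional using (_↭_)

-- A letter i^j is the pair (i , j) : ℕ × ℕ  (letter i, color j).
Letter : Set
Letter = ℕ × ℕ

[1‥_] : ℕ → List ℕ
[1‥ n ] = applyUpTo suc n

IsColoredPerm : ℕ → ℕ → List Letter → Set
IsColoredPerm n r w = (map proj₁ w ↭ [1‥ n ]) × All (λ x → proj₂ x < r) w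

_≺ᵇ_ : Letter → Letter → Bool
(i , j) ≺ᵇ (i' , j') = (j' <ᵇ j) ∨ ((j ≡ᵇ j') ∧ (i <ᵇ i'))

desSum : ℕ → List Letter → ℕ
desSum p []           = 0
desSum p (x ∷ [])     = 0
desSum p (x ∷ y ∷ ws) = (if y ≺ᵇ x then p else 0) + desSum (suc p) (y ∷ ws)

maj : ℕ → List Letter → ℕ
maj r w = r * desSum 1 w + sum (map proj₂ w)

c : ℕ → ℕ → Letter → Letter
c n r (zero , j)        = (zero , j)          -- 0 is not a letter; arbitrary
c n r (suc zero , j)    = if suc j <ᵇ r then (n , suc j) else (n , 0)
c n r (suc (suc k) , j) = (suc k , j)

c∙ : ℕ → ℕ → List Letter → List Letter
c∙ n r w = map (c n r) w

-- The letter 1 occurs exactly once in π, say as 1^j, and c lowers every other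
-- letter i^j to (i-1)^j, which preserves their relative order and their colours.
-- If j < r - 1 then c(1^j) = n^(j+1); like 1^j among the other letters, n^(j+1)
-- is compared with them by colour alone, so no descent changes and only the
-- colour sum grows, by 1.  If j = r - 1 then 1^j is the least letter and
-- c(1^j) = n^0 the greatest; if 1^j sits at position p < n, the descent at
-- p - 1 (present exactly when p > 1) is traded for one at p, adding r to maj,
-- while the colour sum drops by r - 1.
module Submission where

open import Defs
open import Data.Nat using (ℕ; zero; suc; _+_; _∸_; _*_; _≤_; _<_; _<ᵇ_; _≡ᵇ_; z≤n; s≤s)
open import Data.Nat.Properties using (+-assoc; +-suc; +-identityʳ; +-cancelʳ-≡; <⇒≤; ≤-antisym; ≮⇒≥; _<?_)
open import Data.Nat.ListAction using (sum)
open import Data.Nat.Tactic.RingSolver using (solve-∀)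
open import Data.Bool using (true; false; if_then_else_; _∨_)
open import Data.Bool.Properties using (∧-identityʳ; ∧-zeroʳ; ∨-identityʳ)
open import Data.Product using (_×_; _,_; proj₁; proj₂; ∃-syntax)
open import Data.Sum using (_⊎_; inj₁; inj₂)
open import Data.Empty using (⊥-elim)
open import Data.List using (List; []; _∷_; _++_; _∷ʳ_; map; applyUpTo; last)
open import Data.List.Properties using (map-++)
open import Data.List.Relation.Unary.All as All using (All; []; _∷_)
open import Data.List.Relation.Unary.All.Properties using (++⁺; ++⁻)
open import Data.List.Relation.Unary.Any using (here)
open import Data.List.Membership.Propositional using (_∈_)
open import Data.List.Membership.Propositional.Properties using (∈-map⁺; ∈-map⁻; ∈-∃++; ∈-applyUpTo⁻)
open import Data.List.Relation.Binary.Permutation.Propositional using (_↭_; ↭-sym)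
open import Data.List.Relation.Binary.Permutation.Propositional.Properties using (∈-resp-↭; drop-mid)
open import Data.Maybe using (just)
open import Relation.Nullary using (yes; no)
open import Relation.Binary.PropositionalEquality
  using (_≡_; _≢_; refl; sym; trans; cong; cong₂; subst; module ≡-Reasoning)

open ≡-Reasoning

<ᵇ-irrefl : ∀ m → (m <ᵇ m) ≡ false
<ᵇ-irrefl zero    = refl
<ᵇ-irrefl (suc m) = <ᵇ-irrefl m

<ᵇ-true : ∀ {m n} → m < n → (m <ᵇ n) ≡ true
<ᵇ-true {zero}  (s≤s _)   = refl
<ᵇ-true {suc m} (s≤s m<n) = <ᵇ-true m<n

<ᵇ-false : ∀ {m n} → n ≤ m → (m <ᵇ n) ≡ false
<ᵇ-false z≤n      = refl
<ᵇ-false (s≤s n≤m) = <ᵇ-false n≤m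

<ᵇ-∨-≡ᵇ : ∀ m n → ((m <ᵇ n) ∨ (n ≡ᵇ m)) ≡ (m <ᵇ suc n)
<ᵇ-∨-≡ᵇ zero    zero    = refl
<ᵇ-∨-≡ᵇ zero    (suc n) = refl
<ᵇ-∨-≡ᵇ (suc m) zero    = refl
<ᵇ-∨-≡ᵇ (suc m) (suc n) = <ᵇ-∨-≡ᵇ m n

≺ᵇ-irrefl : ∀ x → (x ≺ᵇ x) ≡ false
≺ᵇ-irrefl (i , j) rewrite <ᵇ-irrefl i | <ᵇ-irrefl j | ∧-zeroʳ (j ≡ᵇ j) = refl

-- 1^j is the least and n^j the greatest letter of colour j, so each of them is
-- compared with the letters strictly between 1 and n by colour alone.

1ʲ≺ᵇ : ∀ j k j′ → ((1 , j) ≺ᵇ (suc (suc k) , j′)) ≡ (j′ <ᵇ suc j)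
1ʲ≺ᵇ j k j′ = trans (cong ((j′ <ᵇ j) ∨_) (∧-identityʳ (j ≡ᵇ j′))) (<ᵇ-∨-≡ᵇ j′ j)

≺ᵇ1ʲ : ∀ j k j′ → ((suc k , j′) ≺ᵇ (1 , j)) ≡ (j <ᵇ j′)
≺ᵇ1ʲ j k j′ = trans (cong ((j <ᵇ j′) ∨_) (∧-zeroʳ (j′ ≡ᵇ j))) (∨-identityʳ (j <ᵇ j′))

nʲ≺ᵇ : ∀ {n i} j j′ → i < n → ((n , j) ≺ᵇ (i , j′)) ≡ (j′ <ᵇ j)
nʲ≺ᵇ j j′ i<n rewrite <ᵇ-false (<⇒≤ i<n) =
  trans (cong ((j′ <ᵇ j) ∨_) (∧-zeroʳ (j ≡ᵇ j′))) (∨-identityʳ (j′ <ᵇ j))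

≺ᵇnʲ : ∀ {n i} j j′ → i < n → ((i , j′) ≺ᵇ (n , j)) ≡ (j <ᵇ suc j′)
≺ᵇnʲ j j′ i<n rewrite <ᵇ-true i<n =
  trans (cong ((j <ᵇ j′) ∨_) (∧-identityʳ (j′ ≡ᵇ j))) (<ᵇ-∨-≡ᵇ j j′)

data Ordinary (n r : ℕ) : Letter → Set where
  ordinary : ∀ {k j} → suc (suc k) ≤ n → j < r → Ordinary n r (suc (suc k) , j)

c-ordinary-≺ᵇ : ∀ {n r y z} → Ordinary n r y → Ordinary n r z →
  (c n r z ≺ᵇ c n r y) ≡ (z ≺ᵇ y)
c-ordinary-≺ᵇ (ordinary _ _) (ordinary _ _) = refl

c-ordinary-colour : ∀ {n r z} → Ordinary n r z → proj₂ (c n r z) ≡ proj₂ z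
c-ordinary-colour (ordinary _ _) = refl

c-1ʲ : ∀ {n r j} → suc j < r → c n r (1 , j) ≡ (n , suc j)
c-1ʲ j+1<r rewrite <ᵇ-true j+1<r = refl

c-1ʳ⁻¹ : ∀ {n} j → c n (suc j) (1 , j) ≡ (n , 0)
c-1ʳ⁻¹ j rewrite <ᵇ-irrefl j = refl

module _ (f : Letter → Letter) {P : Letter → Set}
         (f-pres-≺ᵇ : ∀ {y z} → P y → P z → (f z ≺ᵇ f y) ≡ (z ≺ᵇ y)) where

  desSum-map : ∀ p {w} → All P w → desSum p (map f w) ≡ desSum p w
  desSum-map p []             = refl
  desSum-map p (_ ∷ [])       = refl
  desSum-map p (py ∷ pz ∷ pw) =
    cong₂ _+_ (cong (λ b → if b then p else 0) (f-pres-≺ᵇ py pz))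
              (desSum-map (suc p) (pz ∷ pw))

  module _ {x : Letter}
           (x≺ᵇ  : ∀ {z} → P z → (x ≺ᵇ z) ≡ true)
           (≺ᵇx  : ∀ {z} → P z → (z ≺ᵇ x) ≡ false)
           (fx≺ᵇ : ∀ {z} → P z → (f x ≺ᵇ f z) ≡ false)
           (≺ᵇfx : ∀ {z} → P z → (f z ≺ᵇ f x) ≡ true) where

    desSum-map-min↦max : ∀ {α y β} → All P α → P y → All P β →
      desSum 1 (map f (α ++ x ∷ y ∷ β)) ≡ suc (desSum 1 (α ++ x ∷ y ∷ β))
    desSum-map-min↦max [] py pβ
      rewrite ≺ᵇfx py | ≺ᵇx py | desSum-map 2 (py ∷ pβ) = refl
    desSum-map-min↦max {y = y} {β} (pa ∷ pα) py pβ = shifted 1 pa pα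
      where
      shifted : ∀ p {a α} → P a → All P α →
        desSum p (map f (a ∷ α ++ x ∷ y ∷ β)) ≡ suc (desSum p (a ∷ α ++ x ∷ y ∷ β))
      shifted p pa []
        rewrite fx≺ᵇ pa | x≺ᵇ pa | ≺ᵇfx py | ≺ᵇx py | desSum-map (suc (suc p)) (py ∷ pβ) = refl
      shifted p pa (pa′ ∷ pα) =
        trans (cong₂ _+_ (cong (λ b → if b then p else 0) (f-pres-≺ᵇ pa pa′)) (shifted (suc p) pa′ pα))
              (+-suc _ _)

colourSum : List Letter → ℕ
colourSum w = sum (map proj₂ w)

module _ (f : Letter → Letter) {P : Letter → Set}
         (f-colour : ∀ {z} → P z → proj₂ (f z) ≡ proj₂ z) where

  colourSum-map : ∀ {w} → All P w → colourSum (map f w) ≡ colourSum w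
  colourSum-map []        = refl
  colourSum-map (pz ∷ pw) = cong₂ _+_ (f-colour pz) (colourSum-map pw)

  colourSum-map-++ : ∀ {α} x {β} → All P α → All P β →
    colourSum (map f (α ++ x ∷ β)) + proj₂ x ≡ colourSum (α ++ x ∷ β) + proj₂ (f x)
  colourSum-map-++ x {β} [] pβ = begin
    (proj₂ (f x) + colourSum (map f β)) + proj₂ x ≡⟨ cong (λ s → proj₂ (f x) + s + proj₂ x) (colourSum-map pβ) ⟩
    (proj₂ (f x) + colourSum β) + proj₂ x         ≡⟨ swap (proj₂ (f x)) (colourSum β) (proj₂ x) ⟩
    (proj₂ x + colourSum β) + proj₂ (f x)         ∎
    where
    swap : ∀ a s b → (a + s) + b ≡ (b + s) + a
    swap = solve-∀
  colourSum-map-++ x {β} (_∷_ {a} {α} pa pα) pβ = begin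
    (proj₂ (f a) + colourSum (map f (α ++ x ∷ β))) + proj₂ x ≡⟨ +-assoc (proj₂ (f a)) _ _ ⟩
    proj₂ (f a) + (colourSum (map f (α ++ x ∷ β)) + proj₂ x) ≡⟨ cong₂ _+_ (f-colour pa) (colourSum-map-++ x pα pβ) ⟩
    proj₂ a + (colourSum (α ++ x ∷ β) + proj₂ (f x))         ≡⟨ sym (+-assoc (proj₂ a) _ _) ⟩
    (proj₂ a + colourSum (α ++ x ∷ β)) + proj₂ (f x)         ∎

maj-c-1ʲ : ∀ {n r j} α β → suc j < r → All (Ordinary n r) α → All (Ordinary n r) β →
  maj r (c∙ n r (α ++ (1 , j) ∷ β)) ≡ maj r (α ++ (1 , j) ∷ β) + 1
maj-c-1ʲ {n} {r} {j} α β j+1<r oα oβ = begin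
  r * desSum 1 (map (c n r) w) + colourSum (map (c n r) w)
    ≡⟨ cong₂ (λ d s → r * d + s) (desSum-map (c n r) c-pres-≺ᵇ 1 marked) colours ⟩
  r * desSum 1 w + (colourSum w + 1)
    ≡⟨ sym (+-assoc (r * desSum 1 w) _ 1) ⟩
  r * desSum 1 w + colourSum w + 1 ∎
  where
  w : List Letter
  w = α ++ (1 , j) ∷ β

  Marked : Letter → Set
  Marked z = Ordinary n r z ⊎ z ≡ (1 , j)

  marked : All Marked w
  marked = ++⁺ (All.map inj₁ oα) (inj₂ refl ∷ All.map inj₁ oβ)

  c-pres-≺ᵇ : ∀ {y z} → Marked y → Marked z → (c n r z ≺ᵇ c n r y) ≡ (z ≺ᵇ y)
  c-pres-≺ᵇ (inj₁ oy) (inj₁ oz) = c-ordinary-≺ᵇ oy oz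
  c-pres-≺ᵇ (inj₁ (ordinary {k} {j′} k+2≤n _)) (inj₂ refl) rewrite c-1ʲ {n} j+1<r =
    trans (nʲ≺ᵇ (suc j) j′ k+2≤n) (sym (1ʲ≺ᵇ j k j′))
  c-pres-≺ᵇ (inj₂ refl) (inj₁ (ordinary {k} {j′} k+2≤n _)) rewrite c-1ʲ {n} j+1<r =
    trans (≺ᵇnʲ (suc j) j′ k+2≤n) (sym (≺ᵇ1ʲ j (suc k) j′))
  c-pres-≺ᵇ (inj₂ refl) (inj₂ refl) =
    trans (≺ᵇ-irrefl (c n r (1 , j))) (sym (≺ᵇ-irrefl (1 , j)))

  colours : colourSum (map (c n r) w) ≡ colourSum w + 1
  colours = +-cancelʳ-≡ j _ _ (begin
    colourSum (map (c n r) w) + j       ≡⟨ colourSum-map-++ (c n r) c-ordinary-colour (1 , j) oα oβ ⟩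
    colourSum w + proj₂ (c n r (1 , j)) ≡⟨ cong (λ x → colourSum w + proj₂ x) (c-1ʲ j+1<r) ⟩
    colourSum w + suc j                 ≡⟨ sym (+-assoc (colourSum w) 1 j) ⟩
    colourSum w + 1 + j                 ∎)

last-∷ʳ : ∀ {A : Set} (xs : List A) x → last (xs ∷ʳ x) ≡ just x
last-∷ʳ []           x = refl
last-∷ʳ (_ ∷ [])     x = refl
last-∷ʳ (_ ∷ y ∷ xs) x = last-∷ʳ (y ∷ xs) x

maj-c-1ʳ⁻¹ : ∀ {n j} α β → All (Ordinary n (suc j)) α → All (Ordinary n (suc j)) β →
  last (α ++ (1 , j) ∷ β) ≢ just (1 , j) →
  maj (suc j) (c∙ n (suc j) (α ++ (1 , j) ∷ β)) ≡ maj (suc j) (α ++ (1 , j) ∷ β) + 1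
maj-c-1ʳ⁻¹ {n} {j} α [] _ _ not-last = ⊥-elim (not-last (last-∷ʳ α (1 , j)))
maj-c-1ʳ⁻¹ {n} {j} α (y ∷ β) oα (oy ∷ oβ) _ = begin
  suc j * desSum 1 (map c′ w) + colourSum (map c′ w)
    ≡⟨ cong (λ d → suc j * d + colourSum (map c′ w))
            (desSum-map-min↦max c′ c-ordinary-≺ᵇ x≺ᵇ ≺ᵇx fx≺ᵇ ≺ᵇfx oα oy oβ) ⟩
  suc j * suc (desSum 1 w) + colourSum (map c′ w)
    ≡⟨ descent-for-colour j (desSum 1 w) (colourSum (map c′ w)) ⟩
  suc j * desSum 1 w + (colourSum (map c′ w) + j) + 1
    ≡⟨ cong (λ s → suc j * desSum 1 w + s + 1) colours ⟩
  suc j * desSum 1 w + colourSum w + 1 ∎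
  where
  c′ : Letter → Letter
  c′ = c n (suc j)

  w : List Letter
  w = α ++ (1 , j) ∷ y ∷ β

  x≺ᵇ : ∀ {z} → Ordinary n (suc j) z → ((1 , j) ≺ᵇ z) ≡ true
  x≺ᵇ (ordinary {k} {j′} _ j′<r) = trans (1ʲ≺ᵇ j k j′) (<ᵇ-true j′<r)

  ≺ᵇx : ∀ {z} → Ordinary n (suc j) z → (z ≺ᵇ (1 , j)) ≡ false
  ≺ᵇx (ordinary {k} {j′} _ (s≤s j′≤j)) = trans (≺ᵇ1ʲ j (suc k) j′) (<ᵇ-false j′≤j)

  fx≺ᵇ : ∀ {z} → Ordinary n (suc j) z → (c′ (1 , j) ≺ᵇ c′ z) ≡ false
  fx≺ᵇ (ordinary {k} {j′} k+2≤n _) rewrite c-1ʳ⁻¹ {n} j = nʲ≺ᵇ 0 j′ k+2≤n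

  ≺ᵇfx : ∀ {z} → Ordinary n (suc j) z → (c′ z ≺ᵇ c′ (1 , j)) ≡ true
  ≺ᵇfx (ordinary {k} {j′} k+2≤n _) rewrite c-1ʳ⁻¹ {n} j = ≺ᵇnʲ 0 j′ k+2≤n

  descent-for-colour : ∀ i d s → suc i * suc d + s ≡ suc i * d + (s + i) + 1
  descent-for-colour = solve-∀

  colours : colourSum (map c′ w) + j ≡ colourSum w
  colours = begin
    colourSum (map c′ w) + j         ≡⟨ colourSum-map-++ c′ c-ordinary-colour (1 , j) oα (oy ∷ oβ) ⟩
    colourSum w + proj₂ (c′ (1 , j)) ≡⟨ cong (λ x → colourSum w + proj₂ x) (c-1ʳ⁻¹ j) ⟩
    colourSum w + 0                  ≡⟨ +-identityʳ (colourSum w) ⟩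
    colourSum w                      ∎

ordinary-of : ∀ {m r} {z : Letter} → proj₁ z ∈ applyUpTo (2 +_) m → proj₂ z < r → Ordinary (suc m) r z
ordinary-of i∈ j<r with ∈-applyUpTo⁻ (2 +_) i∈
... | _ , k<m , refl = ordinary (s≤s k<m) j<r

letters-off-1 : ∀ {m} α {j} β → map proj₁ (α ++ (1 , j) ∷ β) ↭ [1‥ suc m ] →
  All (λ (z : Letter) → proj₁ z ∈ applyUpTo (2 +_) m) (α ++ β)
letters-off-1 α {j} β perm = All.tabulate (λ z∈ → ∈-resp-↭ rest↭ (∈-map⁺ proj₁ z∈))
  where
  rest↭ : map proj₁ (α ++ β) ↭ _
  rest↭ = subst (_↭ _) (sym (map-++ proj₁ α β))
            (drop-mid (map proj₁ α) [] (subst (_↭ _) (map-++ proj₁ α ((1 , j) ∷ β)) perm))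

split-at-1 : ∀ {m r π} → IsColoredPerm (suc m) r π →
  ∃[ α ] ∃[ j ] ∃[ β ] π ≡ α ++ (1 , j) ∷ β × j < r
    × All (Ordinary (suc m) r) α × All (Ordinary (suc m) r) β
split-at-1 (perm , colours)
  with (_ , j) , 1ʲ∈π , refl ← ∈-map⁻ proj₁ (∈-resp-↭ (↭-sym perm) (here refl))
  with α , β , refl ← ∈-∃++ 1ʲ∈π
  with colours-α , j<r ∷ colours-β ← ++⁻ α colours
  with ordinary-α , ordinary-β ← ++⁻ α (All.zipWith (λ (i∈ , j′<r) → ordinary-of i∈ j′<r)
                                         (letters-off-1 α β perm , ++⁺ colours-α colours-β))
  = α , j , β , refl , j<r , ordinary-α , ordinary-β

lemma4p2 : (n r : ℕ) → 1 ≤ n → 1 ≤ r → (π : List Letter) → IsColoredPerm n r π →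
    last π ≢ just (1 , r ∸ 1) → maj r (c∙ n r π) ≡ maj r π + 1
lemma4p2 (suc m) r _ _ π cπ not-last
  with α , j , β , refl , j<r , ordinary-α , ordinary-β ← split-at-1 cπ
  with suc j <? r
... | yes j+1<r = maj-c-1ʲ α β j+1<r ordinary-α ordinary-β
... | no  j+1≮r with refl ← ≤-antisym (≮⇒≥ j+1≮r) j<r =
  maj-c-1ʳ⁻¹ α β ordinary-α ordinary-β not-last
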